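{- Let $G=(V,E)$ be a graph and let $c$ be a minimum fractional additive stabilizer for $G$. Then every matching of maximum $(\mathbb{1}+c)$-weight in $G$ has cardinality $\nu(G)$, the maximum cardinality of a matching in $G$.
   Context: All graphs are finite, undirected and simple, with unit edge weights. For $w\in\mathbb{R}^E_{\ge 0}$, a fractional $w$-vertex cover is $y\in\mathbb{R}^V_{\ge 0}$ with $y_u+y_v\ge w_{uv}$ for all $\{u,v\}\in E$; $\nu(G,w)$ is the maximum $w$-weight of a matching, $\tau_f(G,w)$ the minimum of $\sum_v y_v$ over fractional $w$-vertex covers; $(G,w)$ is stable if $\nu(G,w)=\tau_f(G,w)$. A fractional additive stabilizer of $G$ is $c\in\mathbb{R}^E_{\ge0}$ with $(G,\mathbb{1}+c)$ stable; it is minimum if $\sum_e c_e$ is smallest among all fractional additive stabilizers.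
   Formalization: The stabilizer c and the fractional vertex covers take rational values instead of real ones, and c is minimum among rational fractional additive stabilizers. -}

module Defs where

open import Data.Nat using (ℕ; zero; suc) renaming (_+_ to _+ℕ_; _≤_ to _≤ℕ_)
open import Data.Fin using (Fin; zero; suc)
open import Data.Bool using (Bool; true; false; if_then_else_)
open import Data.Product using (Σ; _×_; _,_; proj₁; proj₂)
open import Data.Sum using (_⊎_)
open import Data.Rational using (ℚ; 0ℚ; 1ℚ; _+_; _≤_)
open import Relation.Binary.PropositionalEquality using (_≡_; _≢_)
open import Relation.Nullary using (¬_)

record Graph : Set where
  field
    n m : ℕ
    ends : Fin m → Fin n × Fin n
    loopless : ∀ e → proj₁ (ends e) ≢ proj₂ (ends e)
    noParallel : ∀ e f →
      ((proj₁ (ends e) ≡ proj₁ (ends f) × proj₂ (ends e) ≡ proj₂ (ends f)) ⊎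
       (proj₁ (ends e) ≡ proj₂ (ends f) × proj₂ (ends e) ≡ proj₁ (ends f))) →
      e ≡ f

open Graph public

sumℚ : ∀ {k} → (Fin k → ℚ) → ℚ
sumℚ {zero} f = 0ℚ
sumℚ {suc k} f = f zero + sumℚ (λ i → f (suc i))

sumℕ : ∀ {k} → (Fin k → ℕ) → ℕ
sumℕ {zero} f = 0
sumℕ {suc k} f = f zero +ℕ sumℕ (λ i → f (suc i))

Vertex : Graph → Set
Vertex G = Fin (n G)

Edge : Graph → Set
Edge G = Fin (m G)

EdgeWeight : Graph → Set
EdgeWeight G = Edge G → ℚ

VertexWeight : Graph → Set
VertexWeight G = Vertex G → ℚ

EdgeSet : Graph → Set
EdgeSet G = Edge G → Bool

Incident : (G : Graph) → Vertex G → Edge G → Set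
Incident G v e = proj₁ (ends G e) ≡ v ⊎ proj₂ (ends G e) ≡ v

IsMatching : (G : Graph) → EdgeSet G → Set
IsMatching G M = ∀ e f → M e ≡ true → M f ≡ true → e ≢ f →
  ∀ v → Incident G v e → ¬ Incident G v f

weight : (G : Graph) → EdgeWeight G → EdgeSet G → ℚ
weight G w M = sumℚ (λ e → if M e then w e else 0ℚ)

card : (G : Graph) → EdgeSet G → ℕ
card G M = sumℕ (λ e → if M e then 1 else 0)

NonNeg : (G : Graph) → EdgeWeight G → Set
NonNeg G c = ∀ e → 0ℚ ≤ c e

-- matching of maximum w-weight (its weight is ν(G,w))
IsMaxWeightMatching : (G : Graph) → EdgeWeight G → EdgeSet G → Set
IsMaxWeightMatching G w M =
  IsMatching G M × (∀ N → IsMatching G N → weight G w N ≤ weight G w M)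

-- matching of maximum cardinality (its cardinality is ν(G))
IsMaxCardMatching : (G : Graph) → EdgeSet G → Set
IsMaxCardMatching G M =
  IsMatching G M × (∀ N → IsMatching G N → card G N ≤ℕ card G M)

IsFracCover : (G : Graph) → EdgeWeight G → VertexWeight G → Set
IsFracCover G w y =
  (∀ v → 0ℚ ≤ y v) × (∀ e → w e ≤ y (proj₁ (ends G e)) + y (proj₂ (ends G e)))

-- minimum fractional w-vertex cover (its total is τ_f(G,w))
IsMinFracCover : (G : Graph) → EdgeWeight G → VertexWeight G → Set
IsMinFracCover G w y =
  IsFracCover G w y × (∀ z → IsFracCover G w z → sumℚ y ≤ sumℚ z)

-- (G,w) stable : ν(G,w) = τ_f(G,w)
Stable : (G : Graph) → EdgeWeight G → Set
Stable G w = Σ (EdgeSet G) λ M → Σ (VertexWeight G) λ y →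
  IsMaxWeightMatching G w M × IsMinFracCover G w y × weight G w M ≡ sumℚ y

onePlus : (G : Graph) → EdgeWeight G → EdgeWeight G
onePlus G c e = 1ℚ + c e

IsFracAddStabilizer : (G : Graph) → EdgeWeight G → Set
IsFracAddStabilizer G c = NonNeg G c × Stable G (onePlus G c)

IsMinFracAddStabilizer : (G : Graph) → EdgeWeight G → Set
IsMinFracAddStabilizer G c = IsFracAddStabilizer G c ×
  (∀ d → IsFracAddStabilizer G d → sumℚ c ≤ sumℚ d)

-- Let y be a minimum fractional (1+c)-vertex cover and M a maximum (1+c)-weight
-- matching, so that w(M) = Σ y.  Given any matching N, repeatedly take a vertex v
-- saturated by e ∈ M but not by N and put e into N, first removing the N-edge at the
-- other end of e if there is one; this never shrinks N and strictly decreases |M ∖ N|,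
-- so it ends in a matching N′ with |N| ≤ |N′| saturating every M-saturated vertex.
-- Then Σ_{uv ∈ N′} (y_u + y_v) ≥ Σ_{V(M)} y ≥ w(M) = Σ y, so N′ and y witness that
-- d := (y_u + y_v − 1 on the edges uv of N′, 0 elsewhere) is a fractional additive
-- stabilizer.  Minimality of c gives Σ c ≤ Σ d = Σ y − |N′| ≤ |M| + Σ c − |N′|,
-- hence |N| ≤ |N′| ≤ |M|.

{-# OPTIONS --safe #-}
module Submission where

open import Defs
open import Data.Nat as ℕ using (ℕ; zero; suc; z≤n; s≤s)
import Data.Nat.Properties as ℕ
open import Data.Nat.Induction using (<-wellFounded)
open import Data.Fin using (Fin; zero; suc)
open import Data.Fin.Properties using (_≟_; any?; 0≢1+n; suc-injective)
open import Data.Bool using (Bool; true; false; if_then_else_; _∧_; _∨_; not)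
import Data.Bool.Properties as Bool
open import Data.Product using (Σ; ∃; _×_; _,_; proj₁; proj₂)
open import Data.Sum using (_⊎_; inj₁; inj₂)
open import Data.Rational using (ℚ; 0ℚ; 1ℚ; _+_; _-_; -_; _≤_)
import Data.Rational.Properties as ℚ
open import Data.Rational.Solver using (module +-*-Solver)
open +-*-Solver using (solve; _:+_; _:-_; :-_; con; _:=_)
open import Algebra.Properties.CommutativeMonoid.Sum ℚ.+-0-commutativeMonoid
  using (sum; sum-cong-≗; sum-replicate-zero; ∑-distrib-+; ∑-comm)
open import Algebra.Properties.Monoid.Mult ℚ.+-0-monoid
  using (×-homo-+; ×-homo-1) renaming (_×_ to _·_)
open import Function using (_∘_; _on_)
open import Induction.WellFounded using (Acc; acc)
import Relation.Binary.Construct.On as On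
open import Relation.Binary.PropositionalEquality
open import Relation.Nullary using (¬_; Dec; yes; no; does; contradiction)
open import Relation.Nullary.Decidable
  using (_×-dec_; _⊎-dec_; ¬?; decidable-stable; dec-true; dec-false)

+-cancelˡ-≤ : ∀ r {p q} → r + p ≤ r + q → p ≤ q
+-cancelˡ-≤ r {p} {q} r+p≤r+q =
  subst₂ _≤_ (cancel r p) (cancel r q) (ℚ.+-monoʳ-≤ (- r) r+p≤r+q)
  where
  cancel : ∀ r p → - r + (r + p) ≡ p
  cancel = solve 2 (λ r p → :- r :+ (r :+ p) := p) refl

1+[p-1]≡p : ∀ p → 1ℚ + (p - 1ℚ) ≡ p
1+[p-1]≡p = solve 1 (λ p → con 1ℚ :+ (p :- con 1ℚ) := p) refl

p≤q⇒0≤q-p : ∀ {p q} → p ≤ q → 0ℚ ≤ q - p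
p≤q⇒0≤q-p {p} {q} p≤q = subst (_≤ q - p) (ℚ.+-inverseʳ p) (ℚ.+-monoˡ-≤ (- p) p≤q)

p≤p+q : ∀ p {q} → 0ℚ ≤ q → p ≤ p + q
p≤p+q p {q} 0≤q = subst (_≤ p + q) (ℚ.+-identityʳ p) (ℚ.+-monoʳ-≤ p 0≤q)

sumℚ≡sum : ∀ {k} (f : Fin k → ℚ) → sumℚ f ≡ sum f
sumℚ≡sum {zero} f = refl
sumℚ≡sum {suc k} f = cong (f zero +_) (sumℚ≡sum (f ∘ suc))

sumℚ-cong : ∀ {k} {f g : Fin k → ℚ} → (∀ i → f i ≡ g i) → sumℚ f ≡ sumℚ g
sumℚ-cong {f = f} {g} f≗g =
  trans (sumℚ≡sum f) (trans (sum-cong-≗ f≗g) (sym (sumℚ≡sum g)))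

sumℚ-distrib-+ : ∀ {k} (f g : Fin k → ℚ) →
  sumℚ (λ i → f i + g i) ≡ sumℚ f + sumℚ g
sumℚ-distrib-+ {k} f g = begin
  sumℚ (λ i → f i + g i)  ≡⟨ sumℚ≡sum {k} _ ⟩
  sum (λ i → f i + g i)   ≡⟨ ∑-distrib-+ f g ⟩
  sum f + sum g           ≡⟨ sym (cong₂ _+_ (sumℚ≡sum f) (sumℚ≡sum g)) ⟩
  sumℚ f + sumℚ g         ∎
  where open ≡-Reasoning

sumℚ-comm : ∀ {k l} (f : Fin k → Fin l → ℚ) →
  sumℚ (λ i → sumℚ (λ j → f i j)) ≡ sumℚ (λ j → sumℚ (λ i → f i j))
sumℚ-comm {k} {l} f = begin
  sumℚ (λ i → sumℚ (λ j → f i j))  ≡⟨ sumℚ-cong (λ i → sumℚ≡sum (f i)) ⟩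
  sumℚ (λ i → sum (λ j → f i j))   ≡⟨ sumℚ≡sum {k} _ ⟩
  sum (λ i → sum (λ j → f i j))    ≡⟨ ∑-comm f ⟩
  sum (λ j → sum (λ i → f i j))    ≡⟨ sym (sumℚ≡sum {l} _) ⟩
  sumℚ (λ j → sum (λ i → f i j))   ≡⟨ sym (sumℚ-cong (λ j → sumℚ≡sum (λ i → f i j))) ⟩
  sumℚ (λ j → sumℚ (λ i → f i j))  ∎
  where open ≡-Reasoning

sumℚ-zero : ∀ {k} {f : Fin k → ℚ} → (∀ i → f i ≡ 0ℚ) → sumℚ f ≡ 0ℚ
sumℚ-zero {k} f≗0 =
  trans (sumℚ-cong f≗0) (trans (sumℚ≡sum {k} (λ _ → 0ℚ)) (sum-replicate-zero k))

sumℚ-mono : ∀ {k} {f g : Fin k → ℚ} → (∀ i → f i ≤ g i) → sumℚ f ≤ sumℚ g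
sumℚ-mono {zero} f≤g = ℚ.≤-refl
sumℚ-mono {suc k} f≤g = ℚ.+-mono-≤ (f≤g zero) (sumℚ-mono (f≤g ∘ suc))

sumℚ-if-none : ∀ {k} {P : Fin k → Set} (P? : ∀ i → Dec (P i)) {f : Fin k → ℚ} →
  (∀ i → ¬ P i) → sumℚ (λ i → if does (P? i) then f i else 0ℚ) ≡ 0ℚ
sumℚ-if-none P? ¬P = sumℚ-zero (λ i → cong (if_then _ else 0ℚ) (dec-false (P? i) (¬P i)))

sumℚ-if-unique : ∀ {k} {P : Fin k → Set} (P? : ∀ i → Dec (P i)) {f : Fin k → ℚ} →
  (∀ {i j} → P i → P j → i ≡ j) → ∀ {i} → P i →
  sumℚ (λ j → if does (P? j) then f j else 0ℚ) ≡ f i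
sumℚ-if-unique {suc k} P? {f} unique {zero} p with P? zero
... | yes _ = trans (cong (f zero +_) rest≡0) (ℚ.+-identityʳ (f zero))
  where
  rest≡0 : sumℚ (λ j → if does (P? (suc j)) then f (suc j) else 0ℚ) ≡ 0ℚ
  rest≡0 = sumℚ-if-none (P? ∘ suc) (λ i q → 0≢1+n (unique p q))
... | no ¬p = contradiction p ¬p
sumℚ-if-unique {suc k} P? {f} unique {suc i} p with P? zero
... | yes p₀ = contradiction (unique p₀ p) 0≢1+n
... | no _ = trans (ℚ.+-identityˡ _)
               (sumℚ-if-unique (P? ∘ suc) (λ q r → suc-injective (unique q r)) p)

sumℚ-delta : ∀ {k} (f : Fin k → ℚ) i → sumℚ (λ j → if does (i ≟ j) then f j else 0ℚ) ≡ f i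
sumℚ-delta f i = sumℚ-if-unique (i ≟_) (λ i≡j i≡j′ → trans (sym i≡j) i≡j′) refl

sumℚ-pair : ∀ {k} (f : Fin k → ℚ) {i j} → i ≢ j →
  sumℚ (λ l → if does ((i ≟ l) ⊎-dec (j ≟ l)) then f l else 0ℚ) ≡ f i + f j
sumℚ-pair {k} f {i} {j} i≢j = begin
  sumℚ (λ l → if does ((i ≟ l) ⊎-dec (j ≟ l)) then f l else 0ℚ)
    ≡⟨ sumℚ-cong split ⟩
  sumℚ (λ l → δ i l + δ j l)
    ≡⟨ sumℚ-distrib-+ (δ i) (δ j) ⟩
  sumℚ (δ i) + sumℚ (δ j)
    ≡⟨ cong₂ _+_ (sumℚ-delta f i) (sumℚ-delta f j) ⟩
  f i + f j ∎
  where
  open ≡-Reasoning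
  δ : Fin k → Fin k → ℚ
  δ i l = if does (i ≟ l) then f l else 0ℚ
  split : ∀ l → (if does ((i ≟ l) ⊎-dec (j ≟ l)) then f l else 0ℚ) ≡ δ i l + δ j l
  split l with i ≟ l | j ≟ l
  ... | yes refl | yes refl = contradiction refl i≢j
  ... | yes _    | no _     = sym (ℚ.+-identityʳ (f l))
  ... | no _     | yes _    = sym (ℚ.+-identityˡ (f l))
  ... | no _     | no _     = sym (ℚ.+-identityˡ 0ℚ)

count : ∀ {k} → (Fin k → Bool) → ℕ
count K = sumℕ (λ i → if K i then 1 else 0)

count-cong : ∀ {k} {K K′ : Fin k → Bool} → (∀ i → K i ≡ K′ i) → count K ≡ count K′
count-cong {zero} K≗K′ = refl
count-cong {suc k} K≗K′ =
  cong₂ ℕ._+_ (cong (if_then 1 else 0) (K≗K′ zero)) (count-cong (K≗K′ ∘ suc))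

count-drop : ∀ {k} {K K′ : Fin k → Bool} {e} → K e ≡ true → K′ e ≡ false →
  (∀ i → i ≢ e → K i ≡ K′ i) → count K ≡ suc (count K′)
count-drop {suc k} {e = zero} Ke K′e agree rewrite Ke | K′e =
  cong suc (count-cong (λ i → agree (suc i) λ ()))
count-drop {suc k} {K} {K′} {suc e} Ke K′e agree rewrite agree zero (λ ()) =
  trans (cong (_ ℕ.+_) (count-drop Ke K′e (λ i i≢e → agree (suc i) (i≢e ∘ suc-injective))))
        (ℕ.+-suc _ (count (K′ ∘ suc)))

count≡sumℚ : ∀ {k} (K : Fin k → Bool) → sumℚ (λ i → if K i then 1ℚ else 0ℚ) ≡ count K · 1ℚ
count≡sumℚ {zero} K = refl
count≡sumℚ {suc k} K =
  trans (cong₂ _+_ (indicator (K zero)) (count≡sumℚ (K ∘ suc)))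
        (sym (×-homo-+ 1ℚ (if K zero then 1 else 0) (count (K ∘ suc))))
  where
  indicator : ∀ b → (if b then 1ℚ else 0ℚ) ≡ (if b then 1 else 0) · 1ℚ
  indicator true = sym (×-homo-1 1ℚ)
  indicator false = refl

·1ℚ-nonneg : ∀ a → 0ℚ ≤ a · 1ℚ
·1ℚ-nonneg zero = ℚ.≤-refl
·1ℚ-nonneg (suc a) = ℚ.≤-trans (ℚ.<⇒≤ (ℚ.positive⁻¹ 1ℚ)) (p≤p+q 1ℚ (·1ℚ-nonneg a))

·1ℚ-cancel-≤ : ∀ a b → a · 1ℚ ≤ b · 1ℚ → a ℕ.≤ b
·1ℚ-cancel-≤ zero b _ = z≤n
·1ℚ-cancel-≤ (suc a) zero 1+a≤0 =
  contradiction (ℚ.<-≤-trans (ℚ.positive⁻¹ 1ℚ) (ℚ.≤-trans (p≤p+q 1ℚ (·1ℚ-nonneg a)) 1+a≤0))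
                (ℚ.<-irrefl refl)
·1ℚ-cancel-≤ (suc a) (suc b) 1+a≤1+b = s≤s (·1ℚ-cancel-≤ a b (+-cancelˡ-≤ 1ℚ 1+a≤1+b))

-- Matchings, fractional covers and weak duality

module Matchings (G : Graph) where

  end₁ end₂ : Edge G → Vertex G
  end₁ e = proj₁ (ends G e)
  end₂ e = proj₂ (ends G e)

  incident? : ∀ v e → Dec (Incident G v e)
  incident? v e = (end₁ e ≟ v) ⊎-dec (end₂ e ≟ v)

  other-end : ∀ {v e} → Incident G v e →
    ∃ λ w → Incident G w e × (∀ x → Incident G x e → x ≡ v ⊎ x ≡ w)
  other-end {e = e} (inj₁ refl) = end₂ e , inj₂ refl , λ where
    _ (inj₁ refl) → inj₁ refl
    _ (inj₂ refl) → inj₂ refl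
  other-end {e = e} (inj₂ refl) = end₁ e , inj₁ refl , λ where
    _ (inj₁ refl) → inj₂ refl
    _ (inj₂ refl) → inj₁ refl

  SaturatedBy : EdgeSet G → Vertex G → Edge G → Set
  SaturatedBy K v e = K e ≡ true × Incident G v e

  saturatedBy? : ∀ K v e → Dec (SaturatedBy K v e)
  saturatedBy? K v e = (K e Bool.≟ true) ×-dec incident? v e

  Saturated : EdgeSet G → Vertex G → Set
  Saturated K v = ∃ (SaturatedBy K v)

  saturated? : ∀ K v → Dec (Saturated K v)
  saturated? K v = any? (saturatedBy? K v)

  V[_]⊆V[_] : EdgeSet G → EdgeSet G → Set
  V[ K ]⊆V[ L ] = ∀ v → Saturated K v → Saturated L v

  matching-unique : ∀ {K v e f} → IsMatching G K →
    SaturatedBy K v e → SaturatedBy K v f → e ≡ f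
  matching-unique {v = v} {e} {f} K-matching (Ke , v∈e) (Kf , v∈f) with e ≟ f
  ... | yes e≡f = e≡f
  ... | no e≢f = contradiction v∈f (K-matching e f Ke Kf e≢f v v∈e)

  ¬saturated⇒∌ : ∀ {K v e} → ¬ Saturated K v → Incident G v e → K e ≡ false
  ¬saturated⇒∌ {e = e} v-free v∈e = Bool.¬-not λ Ke → v-free (e , Ke , v∈e)

  edgeLoad : VertexWeight G → EdgeWeight G
  edgeLoad z e = z (end₁ e) + z (end₂ e)

  saturatedWeight : EdgeSet G → VertexWeight G → ℚ
  saturatedWeight K z = sumℚ (λ v → if does (saturated? K v) then z v else 0ℚ)

  weight-edgeLoad : ∀ {K} → IsMatching G K → ∀ z →
    weight G (edgeLoad z) K ≡ saturatedWeight K z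
  weight-edgeLoad {K} K-matching z = begin
    sumℚ (λ e → if K e then edgeLoad z e else 0ℚ)  ≡⟨ sym (sumℚ-cong edge-term) ⟩
    sumℚ (λ e → sumℚ (λ v → term e v))           ≡⟨ sumℚ-comm term ⟩
    sumℚ (λ v → sumℚ (λ e → term e v))           ≡⟨ sumℚ-cong vertex-term ⟩
    saturatedWeight K z                          ∎
    where
    open ≡-Reasoning
    term : Edge G → Vertex G → ℚ
    term e v = if does (saturatedBy? K v e) then z v else 0ℚ
    edge-term : ∀ e →
      sumℚ (λ v → if does ((K e Bool.≟ true) ×-dec incident? v e) then z v else 0ℚ)
      ≡ (if K e then edgeLoad z e else 0ℚ)
    edge-term e with K e
    ... | true = sumℚ-pair z (loopless G e)
    ... | false = sumℚ-zero {n G} (λ _ → refl)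
    vertex-term : ∀ v →
      sumℚ (λ e → term e v) ≡ (if does (saturated? K v) then z v else 0ℚ)
    vertex-term v with saturated? K v
    ... | yes (_ , s) = sumℚ-if-unique (saturatedBy? K v) (matching-unique K-matching) s
    ... | no ¬s = sumℚ-if-none (saturatedBy? K v) (λ e s → ¬s (e , s))

  saturatedWeight≤sum : ∀ K {z} → (∀ v → 0ℚ ≤ z v) → saturatedWeight K z ≤ sumℚ z
  saturatedWeight≤sum K {z} z≥0 = sumℚ-mono bound
    where
    bound : ∀ v → (if does (saturated? K v) then z v else 0ℚ) ≤ z v
    bound v with does (saturated? K v)
    ... | true = ℚ.≤-refl
    ... | false = z≥0 v

  saturatedWeight-mono : ∀ {K L z} → V[ K ]⊆V[ L ] → (∀ v → 0ℚ ≤ z v) →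
    saturatedWeight K z ≤ saturatedWeight L z
  saturatedWeight-mono {K} {L} {z} K⊆L z≥0 = sumℚ-mono bound
    where
    bound : ∀ v → (if does (saturated? K v) then z v else 0ℚ)
                ≤ (if does (saturated? L v) then z v else 0ℚ)
    bound v with saturated? K v | saturated? L v
    ... | yes _ | yes _ = ℚ.≤-refl
    ... | yes s | no ¬s = contradiction (K⊆L v s) ¬s
    ... | no _  | yes _ = z≥0 v
    ... | no _  | no _  = ℚ.≤-refl

  weight-mono : ∀ K {w w′} → (∀ e → w e ≤ w′ e) → weight G w K ≤ weight G w′ K
  weight-mono K {w} {w′} w≤w′ = sumℚ-mono bound
    where
    bound : ∀ e → (if K e then w e else 0ℚ) ≤ (if K e then w′ e else 0ℚ)
    bound e with K e
    ... | true = w≤w′ e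
    ... | false = ℚ.≤-refl

  weight≤sum : ∀ K {w} → NonNeg G w → weight G w K ≤ sumℚ w
  weight≤sum K {w} w≥0 = sumℚ-mono bound
    where
    bound : ∀ e → (if K e then w e else 0ℚ) ≤ w e
    bound e with K e
    ... | true = ℚ.≤-refl
    ... | false = w≥0 e

  weight-distrib-+ : ∀ K (w w′ : EdgeWeight G) →
    weight G (λ e → w e + w′ e) K ≡ weight G w K + weight G w′ K
  weight-distrib-+ K w w′ =
    trans (sumℚ-cong split)
          (sumℚ-distrib-+ (λ e → if K e then w e else 0ℚ) (λ e → if K e then w′ e else 0ℚ))
    where
    split : ∀ e → (if K e then w e + w′ e else 0ℚ)
                ≡ (if K e then w e else 0ℚ) + (if K e then w′ e else 0ℚ)
    split e with K e
    ... | true = refl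
    ... | false = sym (ℚ.+-identityˡ 0ℚ)

  weight≤cover : ∀ {K w z} → IsMatching G K → IsFracCover G w z → weight G w K ≤ sumℚ z
  weight≤cover {K} {w} {z} K-matching (z≥0 , w≤load) = begin
    weight G w K             ≤⟨ weight-mono K w≤load ⟩
    weight G (edgeLoad z) K  ≡⟨ weight-edgeLoad K-matching z ⟩
    saturatedWeight K z      ≤⟨ saturatedWeight≤sum K z≥0 ⟩
    sumℚ z                   ∎
    where open ℚ.≤-Reasoning

  tight⇒stable : ∀ {K w z} → IsMatching G K → IsFracCover G w z →
    weight G w K ≡ sumℚ z → Stable G w
  tight⇒stable {K} {w} {z} K-matching z-cover tight =
    K , z ,
    (K-matching , λ N N-matching →
      subst (weight G w N ≤_) (sym tight) (weight≤cover N-matching z-cover)) ,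
    (z-cover , λ z′ z′-cover → subst (_≤ sumℚ z′) tight (weight≤cover K-matching z′-cover)) ,
    tight

  -- Saturating extensions of matchings

  _+ₑ_ _-ₑ_ : EdgeSet G → Edge G → EdgeSet G
  (K +ₑ e) g = does (g ≟ e) ∨ K g
  (K -ₑ e) g = not (does (g ≟ e)) ∧ K g

  _∖_ : EdgeSet G → EdgeSet G → EdgeSet G
  (K ∖ L) g = K g ∧ not (L g)

  +ₑ-here : ∀ K e → (K +ₑ e) e ≡ true
  +ₑ-here K e rewrite dec-true (e ≟ e) refl = refl

  +ₑ-there : ∀ K {e g} → g ≢ e → (K +ₑ e) g ≡ K g
  +ₑ-there K {e} {g} g≢e rewrite dec-false (g ≟ e) g≢e = refl

  +ₑ-inv : ∀ K {e g} → (K +ₑ e) g ≡ true → g ≡ e ⊎ K g ≡ true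
  +ₑ-inv K {e} {g} K+e∋g with g ≟ e
  ... | yes g≡e = inj₁ g≡e
  ... | no _ = inj₂ K+e∋g

  -ₑ-here : ∀ K e → (K -ₑ e) e ≡ false
  -ₑ-here K e rewrite dec-true (e ≟ e) refl = refl

  -ₑ-there : ∀ K {e g} → g ≢ e → (K -ₑ e) g ≡ K g
  -ₑ-there K {e} {g} g≢e rewrite dec-false (g ≟ e) g≢e = refl

  -ₑ-⊆ : ∀ K {e g} → (K -ₑ e) g ≡ true → K g ≡ true
  -ₑ-⊆ K {e} {g} K-e∋g with does (g ≟ e)
  ... | false = K-e∋g

  matching-+ₑ : ∀ {K e} → IsMatching G K → (∀ x → Incident G x e → ¬ Saturated K x) →
    IsMatching G (K +ₑ e)
  matching-+ₑ {K} {e} K-matching e-free f g K+e∋f K+e∋g f≢g x x∈f x∈g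
    with +ₑ-inv K K+e∋f | +ₑ-inv K K+e∋g
  ... | inj₁ refl | inj₁ refl = f≢g refl
  ... | inj₁ refl | inj₂ Kg   = e-free x x∈f (g , Kg , x∈g)
  ... | inj₂ Kf   | inj₁ refl = e-free x x∈g (f , Kf , x∈f)
  ... | inj₂ Kf   | inj₂ Kg   = K-matching f g Kf Kg f≢g x x∈f x∈g

  matching--ₑ : ∀ {K} e → IsMatching G K → IsMatching G (K -ₑ e)
  matching--ₑ {K} e K-matching f g K-e∋f K-e∋g =
    K-matching f g (-ₑ-⊆ K K-e∋f) (-ₑ-⊆ K K-e∋g)

  saturated--ₑ : ∀ {K e x} → Saturated (K -ₑ e) x → Saturated K x
  saturated--ₑ {K} (g , K-e∋g , x∈g) = g , -ₑ-⊆ K K-e∋g , x∈g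

  ¬saturated--ₑ : ∀ {K e x} → IsMatching G K → SaturatedBy K x e → ¬ Saturated (K -ₑ e) x
  ¬saturated--ₑ {K} {e} K-matching x-by-e (g , K-e∋g , x∈g)
    with matching-unique K-matching (-ₑ-⊆ K K-e∋g , x∈g) x-by-e
  ... | refl = contradiction K-e∋g (subst (_≢ true) (sym (-ₑ-here K e)) λ ())

  card-+ₑ : ∀ {K e} → K e ≡ false → card G (K +ₑ e) ≡ suc (card G K)
  card-+ₑ {K} {e} Ke = count-drop (+ₑ-here K e) Ke (λ _ → +ₑ-there K)

  card--ₑ : ∀ {K e} → K e ≡ true → card G K ≡ suc (card G (K -ₑ e))
  card--ₑ {K} {e} Ke = count-drop Ke (-ₑ-here K e) (λ _ g≢e → sym (-ₑ-there K g≢e))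

  card-∖-+ₑ : ∀ {K L e} → K e ≡ true → L e ≡ false → card G (K ∖ L) ≡ suc (card G (K ∖ (L +ₑ e)))
  card-∖-+ₑ {K} {L} {e} Ke Le = count-drop K∖L∋e K∖L+e∌e agree
    where
    K∖L∋e : (K ∖ L) e ≡ true
    K∖L∋e rewrite Ke | Le = refl
    K∖L+e∌e : (K ∖ (L +ₑ e)) e ≡ false
    K∖L+e∌e rewrite +ₑ-here L e = Bool.∧-zeroʳ (K e)
    agree : ∀ g → g ≢ e → (K ∖ L) g ≡ (K ∖ (L +ₑ e)) g
    agree g g≢e = cong (λ b → K g ∧ not b) (sym (+ₑ-there L g≢e))

  card-∖--ₑ : ∀ {K L e} → K e ≡ false → card G (K ∖ (L -ₑ e)) ≡ card G (K ∖ L)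
  card-∖--ₑ {K} {L} {e} Ke = count-cong agree
    where
    agree : ∀ g → (K ∖ (L -ₑ e)) g ≡ (K ∖ L) g
    agree g with g ≟ e
    ... | yes refl rewrite Ke = refl
    ... | no _ = refl

  module Augment {M : EdgeSet G} (M-matching : IsMatching G M) where

    μ : EdgeSet G → ℕ
    μ N = card G (M ∖ N)

    Improvement : EdgeSet G → Set
    Improvement N =
      Σ (EdgeSet G) λ N₁ → IsMatching G N₁ × card G N ℕ.≤ card G N₁ × μ N₁ ℕ.< μ N

    insert-improves : ∀ {N e} → IsMatching G N → M e ≡ true → N e ≡ false →
      (∀ x → Incident G x e → ¬ Saturated N x) →
      IsMatching G (N +ₑ e) × card G (N +ₑ e) ≡ suc (card G N) × μ (N +ₑ e) ℕ.< μ N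
    insert-improves N-matching Me Ne e-free =
      matching-+ₑ N-matching e-free , card-+ₑ Ne , ℕ.≤-reflexive (sym (card-∖-+ₑ Me Ne))

    improve : ∀ {N v e} → IsMatching G N → SaturatedBy M v e → ¬ Saturated N v → Improvement N
    improve {N} {v} {e} N-matching (Me , v∈e) v-free
      with w , w∈e , ends-of-e ← other-end v∈e
      with saturated? N w
    ... | no w-free =
      let N+e-matching , card-N+e , μ< = insert-improves N-matching Me Ne e-free
      in N +ₑ e , N+e-matching , ℕ.≤-trans (ℕ.n≤1+n _) (ℕ.≤-reflexive (sym card-N+e)) , μ<
      where
      Ne : N e ≡ false
      Ne = ¬saturated⇒∌ v-free v∈e
      e-free : ∀ x → Incident G x e → ¬ Saturated N x
      e-free x x∈e with ends-of-e x x∈e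
      ... | inj₁ refl = v-free
      ... | inj₂ refl = w-free
    ... | yes (f , Nf , w∈f) =
      let N′+e-matching , card-N′+e , μ< = insert-improves (matching--ₑ f N-matching) Me N′e e-free
      in N′ +ₑ e , N′+e-matching ,
         ℕ.≤-reflexive (trans (card--ₑ Nf) (sym card-N′+e)) ,
         subst (μ (N′ +ₑ e) ℕ.<_) (card-∖--ₑ Mf) μ<
      where
      N′ : EdgeSet G
      N′ = N -ₑ f
      Ne : N e ≡ false
      Ne = ¬saturated⇒∌ v-free v∈e
      e≢f : e ≢ f
      e≢f refl = contradiction (trans (sym Nf) Ne) λ ()
      Mf : M f ≡ false
      Mf = Bool.¬-not λ Mf → M-matching e f Me Mf e≢f w w∈e w∈f
      N′e : N′ e ≡ false
      N′e = trans (-ₑ-there N e≢f) Ne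
      e-free : ∀ x → Incident G x e → ¬ Saturated N′ x
      e-free x x∈e with ends-of-e x x∈e
      ... | inj₁ refl = v-free ∘ saturated--ₑ
      ... | inj₂ refl = ¬saturated--ₑ N-matching (Nf , w∈f)

    SaturatingExtension : EdgeSet G → Set
    SaturatingExtension N =
      Σ (EdgeSet G) λ N′ → IsMatching G N′ × card G N ℕ.≤ card G N′ × V[ M ]⊆V[ N′ ]

    extend : ∀ N → Acc (ℕ._<_ on μ) N → IsMatching G N → SaturatingExtension N
    extend N (acc rec) N-matching with any? (λ v → saturated? M v ×-dec ¬? (saturated? N v))
    ... | yes (v , (e , v-by-e) , v-free) =
      let N₁ , N₁-matching , N≤N₁ , μ< = improve N-matching v-by-e v-free
          N′ , N′-matching , N₁≤N′ , M⊆N′ = extend N₁ (rec μ<) N₁-matching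
      in N′ , N′-matching , ℕ.≤-trans N≤N₁ N₁≤N′ , M⊆N′
    ... | no none = N , N-matching , ℕ.≤-refl ,
      λ v Mv → decidable-stable (saturated? N v) λ v-free → none (v , Mv , v-free)

    saturating-extension : ∀ {N} → IsMatching G N → SaturatingExtension N
    saturating-extension {N} = extend N (On.wellFounded μ <-wellFounded N)

  -- Stabilizers from saturating matchings

  cardℚ : EdgeSet G → ℚ
  cardℚ K = weight G (λ _ → 1ℚ) K

  excess : EdgeSet G → VertexWeight G → EdgeWeight G
  excess N y e = if N e then edgeLoad y e - 1ℚ else 0ℚ

  cardℚ+excess : ∀ N y → sumℚ (excess N y) + cardℚ N ≡ weight G (edgeLoad y) N
  cardℚ+excess N y =
    trans (sym (sumℚ-distrib-+ (excess N y) (λ e → if N e then 1ℚ else 0ℚ))) (sumℚ-cong split)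
    where
    split : ∀ e → excess N y e + (if N e then 1ℚ else 0ℚ) ≡ (if N e then edgeLoad y e else 0ℚ)
    split e with N e
    ... | true = trans (ℚ.+-comm (edgeLoad y e - 1ℚ) 1ℚ) (1+[p-1]≡p (edgeLoad y e))
    ... | false = ℚ.+-identityˡ 0ℚ

  excess-stabilizer : ∀ {N y} → IsMatching G N → (∀ v → 0ℚ ≤ y v) →
    (∀ e → 1ℚ ≤ edgeLoad y e) → sumℚ y ≤ weight G (edgeLoad y) N →
    IsFracAddStabilizer G (excess N y)
  excess-stabilizer {N} {y} N-matching y≥0 1≤load y≤load =
    excess≥0 ,
    tight⇒stable N-matching y-cover (ℚ.≤-antisym (weight≤cover N-matching y-cover) y≤weight)
    where
    excess≥0 : NonNeg G (excess N y)
    excess≥0 e with N e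
    ... | true = p≤q⇒0≤q-p (1≤load e)
    ... | false = ℚ.≤-refl
    y-cover : IsFracCover G (onePlus G (excess N y)) y
    y-cover = y≥0 , bound
      where
      bound : ∀ e → onePlus G (excess N y) e ≤ edgeLoad y e
      bound e with N e
      ... | true = ℚ.≤-reflexive (1+[p-1]≡p (edgeLoad y e))
      ... | false = subst (_≤ edgeLoad y e) (sym (ℚ.+-identityʳ 1ℚ)) (1≤load e)
    y≤weight : sumℚ y ≤ weight G (onePlus G (excess N y)) N
    y≤weight = subst (sumℚ y ≤_) (sumℚ-cong pointwise) y≤load
      where
      pointwise : ∀ e → (if N e then edgeLoad y e else 0ℚ)
                      ≡ (if N e then onePlus G (excess N y) e else 0ℚ)
      pointwise e with N e
      ... | true = sym (1+[p-1]≡p (edgeLoad y e))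
      ... | false = refl

  card≤-of-minimal-stabilizer : ∀ {c y M N} → NonNeg G c →
    (∀ d → IsFracAddStabilizer G d → sumℚ c ≤ sumℚ d) →
    IsFracCover G (onePlus G c) y → IsMatching G M → weight G (onePlus G c) M ≡ sumℚ y →
    IsMatching G N → V[ M ]⊆V[ N ] → card G N ℕ.≤ card G M
  card≤-of-minimal-stabilizer {c} {y} {M} {N} c≥0 c-minimal (y≥0 , c≤load)
    M-matching M-tight N-matching M⊆N =
    ·1ℚ-cancel-≤ (card G N) (card G M)
      (subst₂ _≤_ (count≡sumℚ N) (count≡sumℚ M) (+-cancelˡ-≤ (sumℚ c) Σc+|N|≤Σc+|M|))
    where
    open ℚ.≤-Reasoning
    y≤load : sumℚ y ≤ weight G (edgeLoad y) N
    y≤load = begin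
      sumℚ y                       ≡⟨ sym M-tight ⟩
      weight G (onePlus G c) M     ≤⟨ weight-mono M c≤load ⟩
      weight G (edgeLoad y) M      ≡⟨ weight-edgeLoad M-matching y ⟩
      saturatedWeight M y          ≤⟨ saturatedWeight-mono M⊆N y≥0 ⟩
      saturatedWeight N y          ≡⟨ sym (weight-edgeLoad N-matching y) ⟩
      weight G (edgeLoad y) N      ∎
    1≤load : ∀ e → 1ℚ ≤ edgeLoad y e
    1≤load e = ℚ.≤-trans (p≤p+q 1ℚ (c≥0 e)) (c≤load e)
    excess-stabilizes : IsFracAddStabilizer G (excess N y)
    excess-stabilizes = excess-stabilizer N-matching y≥0 1≤load y≤load
    Σc+|N|≤Σc+|M| : sumℚ c + cardℚ N ≤ sumℚ c + cardℚ M
    Σc+|N|≤Σc+|M| = begin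
      sumℚ c + cardℚ N
        ≤⟨ ℚ.+-monoˡ-≤ (cardℚ N) (c-minimal (excess N y) excess-stabilizes) ⟩
      sumℚ (excess N y) + cardℚ N   ≡⟨ cardℚ+excess N y ⟩
      weight G (edgeLoad y) N       ≤⟨ weight≤cover N-matching (y≥0 , λ _ → ℚ.≤-refl) ⟩
      sumℚ y                        ≡⟨ sym M-tight ⟩
      weight G (onePlus G c) M      ≡⟨ weight-distrib-+ M (λ _ → 1ℚ) c ⟩
      cardℚ M + weight G c M        ≤⟨ ℚ.+-monoʳ-≤ (cardℚ M) (weight≤sum M c≥0) ⟩
      cardℚ M + sumℚ c              ≡⟨ ℚ.+-comm (cardℚ M) (sumℚ c) ⟩
      sumℚ c + cardℚ M              ∎

lemma2 : (G : Graph) (c : EdgeWeight G) → IsMinFracAddStabilizer G c →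
    (M : EdgeSet G) → IsMaxWeightMatching G (onePlus G c) M →
    IsMaxCardMatching G M
lemma2 G c ((c≥0 , M₀ , y , (M₀-matching , M₀-max) , (y-cover , _) , M₀-tight) , c-minimal)
  M (M-matching , M-max) = M-matching , λ N N-matching →
    let N′ , N′-matching , N≤N′ , M⊆N′ = saturating-extension N-matching
    in ℕ.≤-trans N≤N′
         (card≤-of-minimal-stabilizer c≥0 c-minimal y-cover M-matching M-tight N′-matching M⊆N′)
  where
  open Matchings G
  open Augment M-matching
  M-tight : weight G (onePlus G c) M ≡ sumℚ y
  M-tight = trans (ℚ.≤-antisym (M₀-max M M-matching) (M-max M₀ M₀-matching)) M₀-tight
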